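{- The category $S4_{\Box\Diamond triv}$ is a preorder (any two arrows with the same source and target are equal). Every modality is isomorphic in it to exactly one of the seven modalities $\Box$, $\Box\Diamond\Box$, $\Diamond\Box$, $\Box\Diamond$, $\Diamond\Box\Diamond$, $\Diamond$ and the empty modality $\emptyset$. Among these seven, there is an arrow from $X$ to $Y$ if and only if $Y$ is reachable from $X$ (including $X = Y$) in the directed graph with edges $$\Box\to\Box\Diamond\Box,\quad \Box\Diamond\Box\to\Diamond\Box,\quad \Box\Diamond\Box\to\Box\Diamond,\quad \Diamond\Box\to\Diamond\Box\Diamond,\quad \Box\Diamond\to\Diamond\Box\Diamond,\quad \Diamond\Box\Diamond\to\Diamond,\quad \Box\to\emptyset,\quad \emptyset\to\Diamond.$$
   Context: A modality is a finite (possibly empty) word over $\{\Box, \Diamond\}$, and $MA$ denotes prefixing $M \in \{\Box, \Diamond\}$ to $A$. The category $S4_{\Box\Diamond}$ has the modalities as objects. Its primitive arrow terms are $\mathbf{1}_A : A \vdash A$, $\varepsilon^\Box_A : \Box A \vdash A$, $\varepsilon^\Diamond_A : A \vdash \Diamond A$, $\delta^{\Box\Box}_A : \Box A \vdash \Box\Box A$ and $\delta^{\Diamond\Diamond}_A : \Diamond\Diamond A \vdash \Diamond A$. Arrow terms are closed under composition and under $f : A \vdash B \mapsto Mf : MA \vdash MB$. Arrows are arrow terms modulo the smallest equivalence relation on same-typed terms that is a congruence and contains all instances of the following equations: - the categorial equations $f \circ \mathbf{1}_A = \mathbf{1}_B \circ f = f$ and $h \circ (g \circ f) = (h \circ g)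 \circ f$; - the functorial equations $M\mathbf{1}_A = \mathbf{1}_{MA}$ and $M(g \circ f) = Mg \circ Mf$; - naturality: $\varepsilon^\Box_B \circ \Box f = f \circ \varepsilon^\Box_A$, $\Box\Box f \circ \delta^{\Box\Box}_A = \delta^{\Box\Box}_B \circ \Box f$, $\Diamond f \circ \varepsilon^\Diamond_A = \varepsilon^\Diamond_B \circ f$, and $\delta^{\Diamond\Diamond}_B \circ \Diamond\Diamond f = \Diamond f \circ \delta^{\Diamond\Diamond}_A$ (for $f : A \vdash B$); - comonad equations: $\Box\delta^{\Box\Box}_A \circ \delta^{\Box\Box}_A = \delta^{\Box\Box}_{\Box A} \circ \delta^{\Box\Box}_A$, $\varepsilon^\Box_{\Box A} \circ \delta^{\Box\Box}_A = \mathbf{1}_{\Box A}$, and $\Box\varepsilon^\Box_A \circ \delta^{\Box\Box}_A = \mathbf{1}_{\Box A}$; - monad equations: $\delta^{\Diamond\Diamond}_A \circ \Diamond\delta^{\Diamond\Diamond}_A = \delta^{\Diamond\Diamond}_A \circ \delta^{\Diamond\Diamond}_{\Diamond A}$, $\delta^{\Diamond\Diamond}_A \circ \varepsilon^\Diamond_{\Diamond A} = \mathbf{1}_{\Diamond A}$, and $\delta^{\Diamond\Diamond}_A \circ \Diamond\varepsilon^\Diamond_A = \mathbf{1}_{\Diamond A}$. The category $S4_{\Box\Diamond triv}$ is defined in the same way, but with the following additional equations for all $A$: - $\Box\varepsilon^\Box_A = \varepsilon^\Box_{\Box A}$; - $\Diamond\varepsilon^\Diamond_A = \varepsilon^\Diamond_{\Diamond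 A}$; - $\Diamond\Box\varepsilon^\Diamond_A \circ \varepsilon^\Box_{\Diamond\Box A} = \varepsilon^\Diamond_{\Box\Diamond A} \circ \Box\Diamond\varepsilon^\Box_A$. -}

module Defs where

open import Data.List using (List; []; _∷_)
open import Relation.Binary.Construct.Closure.ReflexiveTransitive using (Star)
open import Relation.Binary.PropositionalEquality using (_≡_)
open import Data.Product using (Σ; _×_)

data Op : Set where
  □ ◇ : Op

-- A modality: finite word over {□, ◇};  M ∷ A  is  MA  (prefixing)
Modality : Set
Modality = List Op

infixr 9 _∘_
data Term : Modality → Modality → Set where
  𝟙    : (A : Modality) → Term A A
  ε□   : (A : Modality) → Term (□ ∷ A) A
  ε◇   : (A : Modality) → Term A (◇ ∷ A)
  δ□□  : (A : Modality) → Term (□ ∷ A) (□ ∷ □ ∷ A)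
  δ◇◇  : (A : Modality) → Term (◇ ∷ ◇ ∷ A) (◇ ∷ A)
  _∘_  : {A B C : Modality} → Term B C → Term A B → Term A C
  app  : {A B : Modality} (M : Op) → Term A B → Term (M ∷ A) (M ∷ B)

infix 4 _≈_
data _≈_ : {A B : Modality} → Term A B → Term A B → Set where
  ≈-refl  : ∀ {A B} {f : Term A B} → f ≈ f
  ≈-sym   : ∀ {A B} {f g : Term A B} → f ≈ g → g ≈ f
  ≈-trans : ∀ {A B} {f g h : Term A B} → f ≈ g → g ≈ h → f ≈ h
  ∘-cong  : ∀ {A B C} {f f' : Term A B} {g g' : Term B C} →
            g ≈ g' → f ≈ f' → g ∘ f ≈ g' ∘ f'
  app-cong : ∀ {A B} (M : Op) {f f' : Term A B} → f ≈ f' → app M f ≈ app M f'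
  idʳ   : ∀ {A B} (f : Term A B) → f ∘ 𝟙 A ≈ f
  idˡ   : ∀ {A B} (f : Term A B) → 𝟙 B ∘ f ≈ f
  assoc : ∀ {A B C D} (f : Term A B) (g : Term B C) (h : Term C D) →
          h ∘ (g ∘ f) ≈ (h ∘ g) ∘ f
  app-id : ∀ (M : Op) (A : Modality) → app M (𝟙 A) ≈ 𝟙 (M ∷ A)
  app-∘  : ∀ {A B C} (M : Op) (f : Term A B) (g : Term B C) →
           app M (g ∘ f) ≈ app M g ∘ app M f
  nat-ε□  : ∀ {A B} (f : Term A B) → ε□ B ∘ app □ f ≈ f ∘ ε□ A
  nat-δ□□ : ∀ {A B} (f : Term A B) →
            app □ (app □ f) ∘ δ□□ A ≈ δ□□ B ∘ app □ f
  nat-ε◇  : ∀ {A B} (f : Term A B) → app ◇ f ∘ ε◇ A ≈ ε◇ B ∘ f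
  nat-δ◇◇ : ∀ {A B} (f : Term A B) →
            δ◇◇ B ∘ app ◇ (app ◇ f) ≈ app ◇ f ∘ δ◇◇ A
  com-assoc : ∀ A → app □ (δ□□ A) ∘ δ□□ A ≈ δ□□ (□ ∷ A) ∘ δ□□ A
  com-idˡ   : ∀ A → ε□ (□ ∷ A) ∘ δ□□ A ≈ 𝟙 (□ ∷ A)
  com-idʳ   : ∀ A → app □ (ε□ A) ∘ δ□□ A ≈ 𝟙 (□ ∷ A)
  mon-assoc : ∀ A → δ◇◇ A ∘ app ◇ (δ◇◇ A) ≈ δ◇◇ A ∘ δ◇◇ (◇ ∷ A)
  mon-idˡ   : ∀ A → δ◇◇ A ∘ ε◇ (◇ ∷ A) ≈ 𝟙 (◇ ∷ A)
  mon-idʳ   : ∀ A → δ◇◇ A ∘ app ◇ (ε◇ A) ≈ 𝟙 (◇ ∷ A)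
  triv□  : ∀ A → app □ (ε□ A) ≈ ε□ (□ ∷ A)
  triv◇  : ∀ A → app ◇ (ε◇ A) ≈ ε◇ (◇ ∷ A)
  triv□◇ : ∀ A → app ◇ (app □ (ε◇ A)) ∘ ε□ (◇ ∷ □ ∷ A)
               ≈ ε◇ (□ ∷ ◇ ∷ A) ∘ app □ (app ◇ (ε□ A))

Iso : Modality → Modality → Set
Iso A B = Σ (Term A B) λ f → Σ (Term B A) λ g → (g ∘ f ≈ 𝟙 A) × (f ∘ g ≈ 𝟙 B)

data Seven : Set where
  s□ s□◇□ s◇□ s□◇ s◇□◇ s◇ s∅ : Seven

rep : Seven → Modality
rep s□    = □ ∷ []
rep s□◇□  = □ ∷ ◇ ∷ □ ∷ []
rep s◇□   = ◇ ∷ □ ∷ []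
rep s□◇   = □ ∷ ◇ ∷ []
rep s◇□◇  = ◇ ∷ □ ∷ ◇ ∷ []
rep s◇    = ◇ ∷ []
rep s∅    = []

data Edge : Seven → Seven → Set where
  e1 : Edge s□ s□◇□
  e2 : Edge s□◇□ s◇□
  e3 : Edge s□◇□ s□◇
  e4 : Edge s◇□ s◇□◇
  e5 : Edge s□◇ s◇□◇
  e6 : Edge s◇□◇ s◇
  e7 : Edge s□ s∅
  e8 : Edge s∅ s◇

Reachable : Seven → Seven → Set
Reachable = Star Edge

-- Prefixing □ or ◇ to one of the seven representatives gives, up to an explicit
-- isomorphism, again a representative: □□ ≅ □ and ◇◇ ≅ ◇ by the first two triv
-- equations, and □◇□◇ ≅ □◇, ◇□◇□ ≅ ◇□ by the third. So every modality A is
-- isomorphic to a representative (classify A), and conjugating by these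
-- isomorphisms turns every arrow A ⊢ B into the composite of the edge arrows along
-- a path from classify A to classify B. The graph commutes (its squares
-- e4∘e2 = e5∘e3 and e6∘e4∘e2∘e1 = e8∘e7 hold), so parallel arrows are equal;
-- and since it is acyclic, isomorphic representatives coincide.

module Submission where

open import Defs
open import Data.Empty using (⊥; ⊥-elim)
open import Data.List using ([]; _∷_)
open import Data.Nat using (ℕ; _≤_; _<_)
open import Data.Nat.Properties using (≤-refl; ≤-trans; <⇒≤; <-≤-trans; <-irrefl; <ᵇ⇒<)
open import Data.Product using (Σ; _×_; _,_; proj₁)
open import Level using (0ℓ)
open import Relation.Binary.Bundles using (Setoid)
open import Relation.Binary.Construct.Closure.ReflexiveTransitive using (Star; ε; _◅_; _◅◅_)
open import Relation.Binary.PropositionalEquality using (_≡_; refl; cong; subst; subst₂)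
import Relation.Binary.Reasoning.Setoid as SetoidReasoning

private variable
  A B C : Modality
  X Y Z : Seven

hom-setoid : Modality → Modality → Setoid 0ℓ 0ℓ
hom-setoid A B = record
  { Carrier       = Term A B
  ; _≈_           = _≈_
  ; isEquivalence = record { refl = ≈-refl ; sym = ≈-sym ; trans = ≈-trans }
  }

module HomReasoning {A B : Modality} = SetoidReasoning (hom-setoid A B)
open HomReasoning

∘-resp-≈ˡ : {g g′ : Term B C} {f : Term A B} → g ≈ g′ → g ∘ f ≈ g′ ∘ f
∘-resp-≈ˡ p = ∘-cong p ≈-refl

∘-resp-≈ʳ : {g : Term B C} {f f′ : Term A B} → f ≈ f′ → g ∘ f ≈ g ∘ f′
∘-resp-≈ʳ p = ∘-cong ≈-refl p

-- Modulo the category and functor laws, an arrow term is the sequence of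
-- primitive arrows it composes, each under the operators applied to it.
data Prim : Modality → Modality → Set where
  pε□  : ∀ A → Prim (□ ∷ A) A
  pε◇  : ∀ A → Prim A (◇ ∷ A)
  pδ□□ : ∀ A → Prim (□ ∷ A) (□ ∷ □ ∷ A)
  pδ◇◇ : ∀ A → Prim (◇ ∷ ◇ ∷ A) (◇ ∷ A)

data Ctx : Set where
  ∙   : Ctx
  _▷_ : Ctx → Op → Ctx

plug : Ctx → Modality → Modality
plug ∙       A = A
plug (w ▷ M) A = plug w (M ∷ A)

data Atom : Modality → Modality → Set where
  at : (w : Ctx) → Prim A B → Atom (plug w A) (plug w B)

Chain : Modality → Modality → Set
Chain = Star Atom

flattenUnder : (w : Ctx) → Term A B → Chain (plug w B) C → Chain (plug w A) C
flattenUnder w (𝟙 A)     k = k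
flattenUnder w (ε□ A)    k = at w (pε□ A) ◅ k
flattenUnder w (ε◇ A)    k = at w (pε◇ A) ◅ k
flattenUnder w (δ□□ A)   k = at w (pδ□□ A) ◅ k
flattenUnder w (δ◇◇ A)   k = at w (pδ◇◇ A) ◅ k
flattenUnder w (g ∘ f)   k = flattenUnder w f (flattenUnder w g k)
flattenUnder w (app M f) k = flattenUnder (w ▷ M) f k

flatten : Term A B → Chain A B
flatten f = flattenUnder ∙ f ε

under : (w : Ctx) → Term A B → Term (plug w A) (plug w B)
under ∙       f = f
under (w ▷ M) f = under w (app M f)

primTerm : Prim A B → Term A B
primTerm (pε□ A)  = ε□ A
primTerm (pε◇ A)  = ε◇ A
primTerm (pδ□□ A) = δ□□ A
primTerm (pδ◇◇ A) = δ◇◇ A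

readback : Chain A B → Term A B
readback ε            = 𝟙 _
readback (at w p ◅ k) = readback k ∘ under w (primTerm p)

under-cong : (w : Ctx) {f g : Term A B} → f ≈ g → under w f ≈ under w g
under-cong ∙       p = p
under-cong (w ▷ M) p = under-cong w (app-cong M p)

under-id : (w : Ctx) (A : Modality) → under w (𝟙 A) ≈ 𝟙 (plug w A)
under-id ∙       A = ≈-refl
under-id (w ▷ M) A = ≈-trans (under-cong w (app-id M A)) (under-id w (M ∷ A))

under-∘ : (w : Ctx) (f : Term A B) (g : Term B C) → under w (g ∘ f) ≈ under w g ∘ under w f
under-∘ ∙       f g = ≈-refl
under-∘ (w ▷ M) f g = ≈-trans (under-cong w (app-∘ M f g)) (under-∘ w (app M f) (app M g))

readback-flattenUnder : (w : Ctx) (f : Term A B) (k : Chain (plug w B) C) →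
                        readback (flattenUnder w f k) ≈ readback k ∘ under w f
readback-flattenUnder w (𝟙 A)     k = ≈-sym (≈-trans (∘-resp-≈ʳ (under-id w A)) (idʳ _))
readback-flattenUnder w (ε□ A)    k = ≈-refl
readback-flattenUnder w (ε◇ A)    k = ≈-refl
readback-flattenUnder w (δ□□ A)   k = ≈-refl
readback-flattenUnder w (δ◇◇ A)   k = ≈-refl
readback-flattenUnder w (app M f) k = readback-flattenUnder (w ▷ M) f k
readback-flattenUnder w (g ∘ f)   k = begin
  readback (flattenUnder w f (flattenUnder w g k)) ≈⟨ readback-flattenUnder w f _ ⟩
  readback (flattenUnder w g k) ∘ under w f        ≈⟨ ∘-resp-≈ˡ (readback-flattenUnder w g k) ⟩
  (readback k ∘ under w g) ∘ under w f             ≈⟨ assoc _ _ _ ⟨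
  readback k ∘ (under w g ∘ under w f)             ≈⟨ ∘-resp-≈ʳ (under-∘ w f g) ⟨
  readback k ∘ under w (g ∘ f)                     ∎

readback-flatten : (f : Term A B) → readback (flatten f) ≈ f
readback-flatten f = ≈-trans (readback-flattenUnder ∙ f ε) (idˡ f)

by-functoriality : {f g : Term A B} → flatten f ≡ flatten g → f ≈ g
by-functoriality {f = f} {g} eq = begin
  f                    ≈⟨ readback-flatten f ⟨
  readback (flatten f) ≡⟨ cong readback eq ⟩
  readback (flatten g) ≈⟨ readback-flatten g ⟩
  g                    ∎

≈-up-to-functoriality : {f f′ g g′ : Term A B} →
                        flatten f ≡ flatten f′ → f′ ≈ g′ → flatten g′ ≡ flatten g → f ≈ g
≈-up-to-functoriality eq p eq′ = ≈-trans (by-functoriality eq) (≈-trans p (by-functoriality eq′))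

edge : Edge X Y → Term (rep X) (rep Y)
edge e1 = app □ (ε◇ (rep s□)) ∘ δ□□ []
edge e2 = ε□ (rep s◇□)
edge e3 = app □ (app ◇ (ε□ []))
edge e4 = app ◇ (app □ (ε◇ []))
edge e5 = ε◇ (rep s□◇)
edge e6 = δ◇◇ [] ∘ app ◇ (ε□ (rep s◇))
edge e7 = ε□ []
edge e8 = ε◇ []

⟦_⟧ : Reachable X Y → Term (rep X) (rep Y)
⟦ ε ⟧     = 𝟙 _
⟦ e ◅ p ⟧ = ⟦ p ⟧ ∘ edge e

⟦◅◅⟧ : (p : Reachable X Y) (q : Reachable Y Z) → ⟦ p ◅◅ q ⟧ ≈ ⟦ q ⟧ ∘ ⟦ p ⟧
⟦◅◅⟧ ε       q = by-functoriality refl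
⟦◅◅⟧ (e ◅ p) q = ≈-trans (∘-resp-≈ˡ (⟦◅◅⟧ p q)) (by-functoriality refl)

e2∘e1≈ε◇ : edge e2 ∘ edge e1 ≈ ε◇ (rep s□)
e2∘e1≈ε◇ = begin
  edge e2 ∘ edge e1                             ≈⟨ by-functoriality refl ⟩
  (ε□ (rep s◇□) ∘ app □ (ε◇ (rep s□))) ∘ δ□□ [] ≈⟨ ∘-resp-≈ˡ (nat-ε□ (ε◇ (rep s□))) ⟩
  (ε◇ (rep s□) ∘ ε□ (rep s□)) ∘ δ□□ []          ≈⟨ by-functoriality refl ⟩
  ε◇ (rep s□) ∘ (ε□ (rep s□) ∘ δ□□ [])          ≈⟨ ∘-resp-≈ʳ (com-idˡ []) ⟩
  ε◇ (rep s□) ∘ 𝟙 _                             ≈⟨ idʳ _ ⟩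
  ε◇ (rep s□)                                   ∎

e6∘e5≈ε□ : edge e6 ∘ edge e5 ≈ ε□ (rep s◇)
e6∘e5≈ε□ = begin
  edge e6 ∘ edge e5                             ≈⟨ by-functoriality refl ⟩
  δ◇◇ [] ∘ (app ◇ (ε□ (rep s◇)) ∘ ε◇ (rep s□◇)) ≈⟨ ∘-resp-≈ʳ (nat-ε◇ (ε□ (rep s◇))) ⟩
  δ◇◇ [] ∘ (ε◇ (rep s◇) ∘ ε□ (rep s◇))          ≈⟨ by-functoriality refl ⟩
  (δ◇◇ [] ∘ ε◇ (rep s◇)) ∘ ε□ (rep s◇)          ≈⟨ ∘-resp-≈ˡ (mon-idˡ []) ⟩
  𝟙 _ ∘ ε□ (rep s◇)                             ≈⟨ idˡ _ ⟩
  ε□ (rep s◇)                                   ∎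

e6∘e4≈◇ε□ : edge e6 ∘ edge e4 ≈ app ◇ (ε□ [])
e6∘e4≈◇ε□ = begin
  edge e6 ∘ edge e4                            ≈⟨ by-functoriality refl ⟩
  δ◇◇ [] ∘ app ◇ (ε□ (rep s◇) ∘ app □ (ε◇ [])) ≈⟨ ∘-resp-≈ʳ (app-cong ◇ (nat-ε□ (ε◇ []))) ⟩
  δ◇◇ [] ∘ app ◇ (ε◇ [] ∘ ε□ [])               ≈⟨ by-functoriality refl ⟩
  (δ◇◇ [] ∘ app ◇ (ε◇ [])) ∘ app ◇ (ε□ [])     ≈⟨ ∘-resp-≈ˡ (mon-idʳ []) ⟩
  𝟙 _ ∘ app ◇ (ε□ [])                          ≈⟨ idˡ _ ⟩
  app ◇ (ε□ [])                                ∎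

e4∘e2≈e5∘e3 : edge e4 ∘ edge e2 ≈ edge e5 ∘ edge e3
e4∘e2≈e5∘e3 = triv□◇ []

e6∘e4∘e2∘e1≈e8∘e7 : edge e6 ∘ edge e4 ∘ edge e2 ∘ edge e1 ≈ edge e8 ∘ edge e7
e6∘e4∘e2∘e1≈e8∘e7 = begin
  edge e6 ∘ edge e4 ∘ edge e2 ∘ edge e1  ≈⟨ ∘-resp-≈ʳ (∘-resp-≈ʳ e2∘e1≈ε◇) ⟩
  edge e6 ∘ edge e4 ∘ ε◇ (rep s□)        ≈⟨ ∘-resp-≈ʳ (nat-ε◇ (app □ (ε◇ []))) ⟩
  edge e6 ∘ ε◇ (rep s□◇) ∘ app □ (ε◇ []) ≈⟨ by-functoriality refl ⟩
  (edge e6 ∘ edge e5) ∘ app □ (ε◇ [])    ≈⟨ ∘-resp-≈ˡ e6∘e5≈ε□ ⟩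
  ε□ (rep s◇) ∘ app □ (ε◇ [])            ≈⟨ nat-ε□ (ε◇ []) ⟩
  edge e8 ∘ edge e7                      ∎

ε□≈e5∘□e6 : ε□ (rep s◇□◇) ≈ edge e5 ∘ app □ (edge e6)
ε□≈e5∘□e6 = begin
  ε□ (rep s◇□◇)                                                 ≈⟨ by-functoriality refl ⟩
  app ◇ (app □ (𝟙 _)) ∘ ε□ (rep s◇□◇)
    ≈⟨ ∘-resp-≈ˡ (app-cong ◇ (app-cong □ (mon-idˡ []))) ⟨
  app ◇ (app □ (δ◇◇ [] ∘ ε◇ (rep s◇))) ∘ ε□ (rep s◇□◇)          ≈⟨ by-functoriality refl ⟩
  app ◇ (app □ (δ◇◇ [])) ∘ app ◇ (app □ (ε◇ (rep s◇))) ∘ ε□ (rep s◇□◇)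
    ≈⟨ ∘-resp-≈ʳ (triv□◇ (rep s◇)) ⟩
  app ◇ (app □ (δ◇◇ [])) ∘ ε◇ (□ ∷ ◇ ∷ ◇ ∷ []) ∘ app □ (app ◇ (ε□ (rep s◇)))
    ≈⟨ by-functoriality refl ⟩
  (app ◇ (app □ (δ◇◇ [])) ∘ ε◇ (□ ∷ ◇ ∷ ◇ ∷ [])) ∘ app □ (app ◇ (ε□ (rep s◇)))
    ≈⟨ ∘-resp-≈ˡ (nat-ε◇ (app □ (δ◇◇ []))) ⟩
  (ε◇ (rep s□◇) ∘ app □ (δ◇◇ [])) ∘ app □ (app ◇ (ε□ (rep s◇))) ≈⟨ by-functoriality refl ⟩
  edge e5 ∘ app □ (edge e6)                                     ∎

◇e1∘e2≈ε◇ : app ◇ (edge e1) ∘ edge e2 ≈ ε◇ (rep s□◇□)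
◇e1∘e2≈ε◇ = begin
  app ◇ (edge e1) ∘ edge e2                                   ≈⟨ by-functoriality refl ⟩
  app ◇ (app □ (ε◇ (rep s□))) ∘ app ◇ (δ□□ []) ∘ ε□ (rep s◇□) ≈⟨ ∘-resp-≈ʳ (nat-ε□ (app ◇ (δ□□ []))) ⟨
  app ◇ (app □ (ε◇ (rep s□))) ∘ ε□ (◇ ∷ □ ∷ □ ∷ []) ∘ app □ (app ◇ (δ□□ []))
    ≈⟨ by-functoriality refl ⟩
  (app ◇ (app □ (ε◇ (rep s□))) ∘ ε□ (◇ ∷ □ ∷ □ ∷ [])) ∘ app □ (app ◇ (δ□□ []))
    ≈⟨ ∘-resp-≈ˡ (triv□◇ (rep s□)) ⟩
  (ε◇ (rep s□◇□) ∘ app □ (app ◇ (ε□ (rep s□)))) ∘ app □ (app ◇ (δ□□ []))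
    ≈⟨ by-functoriality refl ⟩
  ε◇ (rep s□◇□) ∘ app □ (app ◇ (ε□ (rep s□) ∘ δ□□ []))
    ≈⟨ ∘-resp-≈ʳ (app-cong □ (app-cong ◇ (com-idˡ []))) ⟩
  ε◇ (rep s□◇□) ∘ app □ (app ◇ (𝟙 _))                         ≈⟨ by-functoriality refl ⟩
  ε◇ (rep s□◇□)                                               ∎

-- □◇ and ◇□ share a level, as do □◇□ and ∅, so neither pair is joined by a path.
level : Seven → ℕ
level s□   = 0
level s□◇□ = 1
level s◇□  = 2
level s□◇  = 2
level s◇□◇ = 3
level s◇   = 4
level s∅   = 1

level-increasing : Edge X Y → level X < level Y
level-increasing e1 = <ᵇ⇒< _ _ _
level-increasing e2 = <ᵇ⇒< _ _ _
level-increasing e3 = <ᵇ⇒< _ _ _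
level-increasing e4 = <ᵇ⇒< _ _ _
level-increasing e5 = <ᵇ⇒< _ _ _
level-increasing e6 = <ᵇ⇒< _ _ _
level-increasing e7 = <ᵇ⇒< _ _ _
level-increasing e8 = <ᵇ⇒< _ _ _

level-monotone : Reachable X Y → level X ≤ level Y
level-monotone ε       = ≤-refl
level-monotone (e ◅ p) = ≤-trans (<⇒≤ (level-increasing e)) (level-monotone p)

no-path-within-level : level X ≡ level Z → Edge X Y → Reachable Y Z → ⊥
no-path-within-level eq e p = <-irrefl eq (<-≤-trans (level-increasing e) (level-monotone p))

reachable-antisym : Reachable X Y → Reachable Y X → X ≡ Y
reachable-antisym ε       _ = refl
reachable-antisym (e ◅ p) q = ⊥-elim (no-path-within-level refl e (p ◅◅ q))

-- Parallel paths can only fork at □◇□ (e2 vs e3) or at □ (e1 vs e7), and must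
-- meet again at ◇□◇ resp. ◇.
mutual
  ⟦⟧-unique : (p q : Reachable X Y) → ⟦ p ⟧ ≈ ⟦ q ⟧
  ⟦⟧-unique ε       ε       = ≈-refl
  ⟦⟧-unique ε       (e ◅ q) = ⊥-elim (no-path-within-level refl e q)
  ⟦⟧-unique (e ◅ p) ε       = ⊥-elim (no-path-within-level refl e p)
  ⟦⟧-unique (e ◅ p) (d ◅ q) = ⟦⟧-unique-branch e d p q

  ⟦⟧-unique-branch : {Y′ : Seven} (e : Edge X Y) (d : Edge X Y′) (p : Reachable Y Z) (q : Reachable Y′ Z) →
                     ⟦ p ⟧ ∘ edge e ≈ ⟦ q ⟧ ∘ edge d
  ⟦⟧-unique-branch e1 e1 p q = ∘-resp-≈ˡ (⟦⟧-unique p q)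
  ⟦⟧-unique-branch e2 e2 p q = ∘-resp-≈ˡ (⟦⟧-unique p q)
  ⟦⟧-unique-branch e3 e3 p q = ∘-resp-≈ˡ (⟦⟧-unique p q)
  ⟦⟧-unique-branch e4 e4 p q = ∘-resp-≈ˡ (⟦⟧-unique p q)
  ⟦⟧-unique-branch e5 e5 p q = ∘-resp-≈ˡ (⟦⟧-unique p q)
  ⟦⟧-unique-branch e6 e6 p q = ∘-resp-≈ˡ (⟦⟧-unique p q)
  ⟦⟧-unique-branch e7 e7 p q = ∘-resp-≈ˡ (⟦⟧-unique p q)
  ⟦⟧-unique-branch e8 e8 p q = ∘-resp-≈ˡ (⟦⟧-unique p q)
  ⟦⟧-unique-branch e2 e3 p q = ⟦⟧-diamond p q
  ⟦⟧-unique-branch e3 e2 p q = ≈-sym (⟦⟧-diamond q p)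
  ⟦⟧-unique-branch e1 e7 p q = ⟦⟧-square p q
  ⟦⟧-unique-branch e7 e1 p q = ≈-sym (⟦⟧-square q p)

  ⟦⟧-diamond : (p : Reachable s◇□ Z) (q : Reachable s□◇ Z) → ⟦ p ⟧ ∘ edge e2 ≈ ⟦ q ⟧ ∘ edge e3
  ⟦⟧-diamond ε        (e5 ◅ q) = ⊥-elim (no-path-within-level refl e5 q)
  ⟦⟧-diamond (e4 ◅ p) ε        = ⊥-elim (no-path-within-level refl e4 p)
  ⟦⟧-diamond (e4 ◅ p) (e5 ◅ q) = begin
    (⟦ p ⟧ ∘ edge e4) ∘ edge e2 ≈⟨ by-functoriality refl ⟩
    ⟦ p ⟧ ∘ edge e4 ∘ edge e2   ≈⟨ ∘-resp-≈ʳ e4∘e2≈e5∘e3 ⟩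
    ⟦ p ⟧ ∘ edge e5 ∘ edge e3   ≈⟨ ∘-resp-≈ˡ (⟦⟧-unique p q) ⟩
    ⟦ q ⟧ ∘ edge e5 ∘ edge e3   ≈⟨ by-functoriality refl ⟩
    (⟦ q ⟧ ∘ edge e5) ∘ edge e3 ∎

  ⟦⟧-square : (p : Reachable s□◇□ Z) (q : Reachable s∅ Z) → ⟦ p ⟧ ∘ edge e1 ≈ ⟦ q ⟧ ∘ edge e7
  ⟦⟧-square (e ◅ p) ε = ⊥-elim (no-path-within-level refl e p)
  ⟦⟧-square p (e8 ◅ () ◅ _)
  ⟦⟧-square (e2 ◅ e4 ◅ e6 ◅ () ◅ _) (e8 ◅ ε)
  ⟦⟧-square (e3 ◅ e5 ◅ e6 ◅ () ◅ _) (e8 ◅ ε)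
  ⟦⟧-square (e2 ◅ e4 ◅ e6 ◅ ε) (e8 ◅ ε) = begin
    ⟦ e2 ◅ e4 ◅ e6 ◅ ε ⟧ ∘ edge e1        ≈⟨ by-functoriality refl ⟩
    edge e6 ∘ edge e4 ∘ edge e2 ∘ edge e1 ≈⟨ e6∘e4∘e2∘e1≈e8∘e7 ⟩
    edge e8 ∘ edge e7                     ≈⟨ by-functoriality refl ⟩
    ⟦ e8 ◅ ε ⟧ ∘ edge e7                  ∎
  ⟦⟧-square (e3 ◅ e5 ◅ e6 ◅ ε) (e8 ◅ ε) = begin
    ⟦ e3 ◅ e5 ◅ e6 ◅ ε ⟧ ∘ edge e1          ≈⟨ by-functoriality refl ⟩
    edge e6 ∘ (edge e5 ∘ edge e3) ∘ edge e1 ≈⟨ ∘-resp-≈ʳ (∘-resp-≈ˡ e4∘e2≈e5∘e3) ⟨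
    edge e6 ∘ (edge e4 ∘ edge e2) ∘ edge e1 ≈⟨ by-functoriality refl ⟩
    edge e6 ∘ edge e4 ∘ edge e2 ∘ edge e1   ≈⟨ e6∘e4∘e2∘e1≈e8∘e7 ⟩
    edge e8 ∘ edge e7                       ≈⟨ by-functoriality refl ⟩
    ⟦ e8 ◅ ε ⟧ ∘ edge e7                    ∎

prefix : Op → Seven → Seven
prefix □ s□   = s□
prefix □ s□◇□ = s□◇□
prefix □ s◇□  = s□◇□
prefix □ s□◇  = s□◇
prefix □ s◇□◇ = s□◇
prefix □ s◇   = s□◇
prefix □ s∅   = s□
prefix ◇ s□   = s◇□
prefix ◇ s□◇□ = s◇□
prefix ◇ s◇□  = s◇□
prefix ◇ s□◇  = s◇□◇
prefix ◇ s◇□◇ = s◇□◇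
prefix ◇ s◇   = s◇
prefix ◇ s∅   = s◇

classify : Modality → Seven
classify []      = s∅
classify (M ∷ A) = prefix M (classify A)

classify-rep : (X : Seven) → classify (rep X) ≡ X
classify-rep s□   = refl
classify-rep s□◇□ = refl
classify-rep s◇□  = refl
classify-rep s□◇  = refl
classify-rep s◇□◇ = refl
classify-rep s◇   = refl
classify-rep s∅   = refl

collapse : (M : Op) (X : Seven) → Term (M ∷ rep X) (rep (prefix M X))
collapse □ s□   = ε□ (rep s□)
collapse □ s□◇□ = ε□ (rep s□◇□)
collapse □ s◇□  = 𝟙 _
collapse □ s□◇  = ε□ (rep s□◇)
collapse □ s◇□◇ = app □ (edge e6)
collapse □ s◇   = 𝟙 _
collapse □ s∅   = 𝟙 _
collapse ◇ s□   = 𝟙 _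
collapse ◇ s□◇□ = δ◇◇ (rep s□) ∘ app ◇ (edge e2)
collapse ◇ s◇□  = δ◇◇ (rep s□)
collapse ◇ s□◇  = 𝟙 _
collapse ◇ s◇□◇ = δ◇◇ (rep s□◇)
collapse ◇ s◇   = δ◇◇ []
collapse ◇ s∅   = 𝟙 _

expand : (M : Op) (X : Seven) → Term (rep (prefix M X)) (M ∷ rep X)
expand □ s□   = δ□□ []
expand □ s□◇□ = δ□□ (rep s◇□)
expand □ s◇□  = 𝟙 _
expand □ s□◇  = δ□□ (rep s◇)
expand □ s◇□◇ = app □ (edge e5) ∘ δ□□ (rep s◇)
expand □ s◇   = 𝟙 _
expand □ s∅   = 𝟙 _
expand ◇ s□   = 𝟙 _
expand ◇ s□◇□ = app ◇ (edge e1)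
expand ◇ s◇□  = ε◇ (rep s◇□)
expand ◇ s□◇  = 𝟙 _
expand ◇ s◇□◇ = ε◇ (rep s◇□◇)
expand ◇ s◇   = ε◇ (rep s◇)
expand ◇ s∅   = 𝟙 _

δ□□∘ε□≈id : (A : Modality) → δ□□ A ∘ ε□ (□ ∷ A) ≈ 𝟙 (□ ∷ □ ∷ A)
δ□□∘ε□≈id A = begin
  δ□□ A ∘ ε□ (□ ∷ A)                 ≈⟨ nat-ε□ (δ□□ A) ⟨
  ε□ (□ ∷ □ ∷ A) ∘ app □ (δ□□ A)     ≈⟨ ∘-resp-≈ˡ (triv□ (□ ∷ A)) ⟨
  app □ (ε□ (□ ∷ A)) ∘ app □ (δ□□ A) ≈⟨ app-∘ □ _ _ ⟨
  app □ (ε□ (□ ∷ A) ∘ δ□□ A)         ≈⟨ app-cong □ (com-idˡ A) ⟩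
  app □ (𝟙 _)                        ≈⟨ app-id □ _ ⟩
  𝟙 _                                ∎

ε◇∘δ◇◇≈id : (A : Modality) → ε◇ (◇ ∷ A) ∘ δ◇◇ A ≈ 𝟙 (◇ ∷ ◇ ∷ A)
ε◇∘δ◇◇≈id A = begin
  ε◇ (◇ ∷ A) ∘ δ◇◇ A                 ≈⟨ nat-ε◇ (δ◇◇ A) ⟨
  app ◇ (δ◇◇ A) ∘ ε◇ (◇ ∷ ◇ ∷ A)     ≈⟨ ∘-resp-≈ʳ (triv◇ (◇ ∷ A)) ⟨
  app ◇ (δ◇◇ A) ∘ app ◇ (ε◇ (◇ ∷ A)) ≈⟨ app-∘ ◇ _ _ ⟨
  app ◇ (δ◇◇ A ∘ ε◇ (◇ ∷ A))         ≈⟨ app-cong ◇ (mon-idˡ A) ⟩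
  app ◇ (𝟙 _)                        ≈⟨ app-id ◇ _ ⟩
  𝟙 _                                ∎

expand∘collapse≈id : (M : Op) (X : Seven) → expand M X ∘ collapse M X ≈ 𝟙 _
expand∘collapse≈id □ s□   = δ□□∘ε□≈id []
expand∘collapse≈id □ s□◇□ = δ□□∘ε□≈id _
expand∘collapse≈id □ s◇□  = idˡ _
expand∘collapse≈id □ s□◇  = δ□□∘ε□≈id _
expand∘collapse≈id □ s◇□◇ = begin
  (app □ (edge e5) ∘ δ□□ (rep s◇)) ∘ app □ (edge e6)         ≈⟨ by-functoriality refl ⟩
  app □ (edge e5) ∘ δ□□ (rep s◇) ∘ app □ (edge e6)           ≈⟨ ∘-resp-≈ʳ (nat-δ□□ (edge e6)) ⟨
  app □ (edge e5) ∘ app □ (app □ (edge e6)) ∘ δ□□ (rep s◇□◇) ≈⟨ by-functoriality refl ⟩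
  app □ (edge e5 ∘ app □ (edge e6)) ∘ δ□□ (rep s◇□◇)         ≈⟨ ∘-resp-≈ˡ (app-cong □ ε□≈e5∘□e6) ⟨
  app □ (ε□ (rep s◇□◇)) ∘ δ□□ (rep s◇□◇)                     ≈⟨ com-idʳ _ ⟩
  𝟙 _                                                        ∎
expand∘collapse≈id □ s◇   = idˡ _
expand∘collapse≈id □ s∅   = idˡ _
expand∘collapse≈id ◇ s□   = idˡ _
expand∘collapse≈id ◇ s□◇□ = begin
  app ◇ (edge e1) ∘ δ◇◇ (rep s□) ∘ app ◇ (edge e2)             ≈⟨ by-functoriality refl ⟩
  (app ◇ (edge e1) ∘ δ◇◇ (rep s□)) ∘ app ◇ (edge e2)           ≈⟨ ∘-resp-≈ˡ (nat-δ◇◇ (edge e1)) ⟨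
  (δ◇◇ (rep s□◇□) ∘ app ◇ (app ◇ (edge e1))) ∘ app ◇ (edge e2) ≈⟨ by-functoriality refl ⟩
  δ◇◇ (rep s□◇□) ∘ app ◇ (app ◇ (edge e1) ∘ edge e2)           ≈⟨ ∘-resp-≈ʳ (app-cong ◇ ◇e1∘e2≈ε◇) ⟩
  δ◇◇ (rep s□◇□) ∘ app ◇ (ε◇ (rep s□◇□))                       ≈⟨ mon-idʳ _ ⟩
  𝟙 _                                                          ∎
expand∘collapse≈id ◇ s◇□  = ε◇∘δ◇◇≈id _
expand∘collapse≈id ◇ s□◇  = idˡ _
expand∘collapse≈id ◇ s◇□◇ = ε◇∘δ◇◇≈id _
expand∘collapse≈id ◇ s◇   = ε◇∘δ◇◇≈id _
expand∘collapse≈id ◇ s∅   = idˡ _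

collapse∘expand≈id : (M : Op) (X : Seven) → collapse M X ∘ expand M X ≈ 𝟙 _
collapse∘expand≈id □ s□   = com-idˡ _
collapse∘expand≈id □ s□◇□ = com-idˡ _
collapse∘expand≈id □ s◇□  = idˡ _
collapse∘expand≈id □ s□◇  = com-idˡ _
collapse∘expand≈id □ s◇□◇ = begin
  app □ (edge e6) ∘ app □ (edge e5) ∘ δ□□ (rep s◇) ≈⟨ by-functoriality refl ⟩
  app □ (edge e6 ∘ edge e5) ∘ δ□□ (rep s◇)         ≈⟨ ∘-resp-≈ˡ (app-cong □ e6∘e5≈ε□) ⟩
  app □ (ε□ (rep s◇)) ∘ δ□□ (rep s◇)               ≈⟨ com-idʳ _ ⟩
  𝟙 _                                              ∎
collapse∘expand≈id □ s◇   = idˡ _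
collapse∘expand≈id □ s∅   = idˡ _
collapse∘expand≈id ◇ s□   = idˡ _
collapse∘expand≈id ◇ s□◇□ = begin
  (δ◇◇ (rep s□) ∘ app ◇ (edge e2)) ∘ app ◇ (edge e1) ≈⟨ by-functoriality refl ⟩
  δ◇◇ (rep s□) ∘ app ◇ (edge e2 ∘ edge e1)           ≈⟨ ∘-resp-≈ʳ (app-cong ◇ e2∘e1≈ε◇) ⟩
  δ◇◇ (rep s□) ∘ app ◇ (ε◇ (rep s□))                 ≈⟨ mon-idʳ _ ⟩
  𝟙 _                                                ∎
collapse∘expand≈id ◇ s◇□  = mon-idˡ _
collapse∘expand≈id ◇ s□◇  = idˡ _
collapse∘expand≈id ◇ s◇□◇ = mon-idˡ _
collapse∘expand≈id ◇ s◇   = mon-idˡ _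
collapse∘expand≈id ◇ s∅   = idˡ _

toRep : (A : Modality) → Term A (rep (classify A))
toRep []      = 𝟙 []
toRep (M ∷ A) = collapse M (classify A) ∘ app M (toRep A)

fromRep : (A : Modality) → Term (rep (classify A)) A
fromRep []      = 𝟙 []
fromRep (M ∷ A) = app M (fromRep A) ∘ expand M (classify A)

fromRep∘toRep≈id : (A : Modality) → fromRep A ∘ toRep A ≈ 𝟙 A
fromRep∘toRep≈id []      = idˡ _
fromRep∘toRep≈id (M ∷ A) = begin
  (app M (fromRep A) ∘ expand M c) ∘ collapse M c ∘ app M (toRep A) ≈⟨ by-functoriality refl ⟩
  app M (fromRep A) ∘ (expand M c ∘ collapse M c) ∘ app M (toRep A)
    ≈⟨ ∘-resp-≈ʳ (∘-resp-≈ˡ (expand∘collapse≈id M c)) ⟩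
  app M (fromRep A) ∘ 𝟙 _ ∘ app M (toRep A)                         ≈⟨ by-functoriality refl ⟩
  app M (fromRep A ∘ toRep A)                                       ≈⟨ app-cong M (fromRep∘toRep≈id A) ⟩
  app M (𝟙 A)                                                       ≈⟨ app-id M A ⟩
  𝟙 _                                                               ∎
  where c = classify A

toRep∘fromRep≈id : (A : Modality) → toRep A ∘ fromRep A ≈ 𝟙 (rep (classify A))
toRep∘fromRep≈id []      = idˡ _
toRep∘fromRep≈id (M ∷ A) = begin
  (collapse M c ∘ app M (toRep A)) ∘ app M (fromRep A) ∘ expand M c ≈⟨ by-functoriality refl ⟩
  collapse M c ∘ app M (toRep A ∘ fromRep A) ∘ expand M c
    ≈⟨ ∘-resp-≈ʳ (∘-resp-≈ˡ (app-cong M (toRep∘fromRep≈id A))) ⟩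
  collapse M c ∘ app M (𝟙 _) ∘ expand M c                           ≈⟨ by-functoriality refl ⟩
  collapse M c ∘ expand M c                                         ≈⟨ collapse∘expand≈id M c ⟩
  𝟙 _                                                               ∎
  where c = classify A

classify-iso : (A : Modality) → Iso A (rep (classify A))
classify-iso A = toRep A , fromRep A , fromRep∘toRep≈id A , toRep∘fromRep≈id A

PathSquare : Term A (rep X) → Term B (rep Y) → Term A B → Set
PathSquare {X = X} {Y = Y} u v f = Σ (Reachable X Y) λ p → v ∘ f ≈ ⟦ p ⟧ ∘ u

PathSquare-resp-≈ : {u : Term A (rep X)} {v : Term B (rep Y)} {f f′ : Term A B} →
                    f ≈ f′ → PathSquare u v f′ → PathSquare u v f
PathSquare-resp-≈ f≈f′ (p , sq) = p , ≈-trans (∘-resp-≈ʳ f≈f′) sq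

PathSquare-paste : {u : Term A (rep X)} {v : Term B (rep Y)} {w : Term C (rep Z)} {f : Term A B} {g : Term B C} →
                   PathSquare u v f → PathSquare v w g → PathSquare u w (g ∘ f)
PathSquare-paste {u = u} {v} {w} {f} {g} (p , vf) (q , wg) = p ◅◅ q , (begin
  w ∘ g ∘ f           ≈⟨ by-functoriality refl ⟩
  (w ∘ g) ∘ f         ≈⟨ ∘-resp-≈ˡ wg ⟩
  (⟦ q ⟧ ∘ v) ∘ f     ≈⟨ by-functoriality refl ⟩
  ⟦ q ⟧ ∘ v ∘ f       ≈⟨ ∘-resp-≈ʳ vf ⟩
  ⟦ q ⟧ ∘ ⟦ p ⟧ ∘ u   ≈⟨ by-functoriality refl ⟩
  (⟦ q ⟧ ∘ ⟦ p ⟧) ∘ u ≈⟨ ∘-resp-≈ˡ (⟦◅◅⟧ p q) ⟨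
  ⟦ p ◅◅ q ⟧ ∘ u      ∎)

collapse-edge : (M : Op) (e : Edge X Y) → PathSquare (collapse M X) (collapse M Y) (app M (edge e))
collapse-edge □ e1 = e1 ◅ ε , ≈-trans (nat-ε□ (edge e1)) (by-functoriality refl)
collapse-edge □ e2 = ε , ≈-up-to-functoriality refl (triv□ (rep s◇□)) refl
collapse-edge □ e3 = e3 ◅ ε , ≈-trans (nat-ε□ (edge e3)) (by-functoriality refl)
collapse-edge □ e4 = e3 ◅ ε , ≈-up-to-functoriality refl (app-cong □ e6∘e4≈◇ε□) refl
collapse-edge □ e5 = ε , ≈-up-to-functoriality refl (≈-trans (app-cong □ e6∘e5≈ε□) (triv□ (rep s◇))) refl
collapse-edge □ e6 = ε , by-functoriality refl
collapse-edge □ e7 = ε , ≈-up-to-functoriality refl (triv□ []) refl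
collapse-edge □ e8 = e1 ◅ e3 ◅ ε , (begin
  𝟙 _ ∘ app □ (ε◇ [])                          ≈⟨ by-functoriality refl ⟩
  app □ (ε◇ []) ∘ 𝟙 _                          ≈⟨ ∘-resp-≈ʳ (com-idʳ []) ⟨
  app □ (ε◇ []) ∘ app □ (ε□ []) ∘ δ□□ []       ≈⟨ by-functoriality refl ⟩
  app □ (ε◇ [] ∘ ε□ []) ∘ δ□□ []               ≈⟨ ∘-resp-≈ˡ (app-cong □ (nat-ε◇ (ε□ []))) ⟨
  app □ (app ◇ (ε□ []) ∘ ε◇ (rep s□)) ∘ δ□□ [] ≈⟨ by-functoriality refl ⟩
  ⟦ e1 ◅ e3 ◅ ε ⟧ ∘ 𝟙 _                        ∎)
collapse-edge ◇ e1 = ε , ≈-trans (collapse∘expand≈id ◇ s□◇□) (by-functoriality refl)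
collapse-edge ◇ e2 = ε , by-functoriality refl
collapse-edge ◇ e3 = e4 ◅ ε , (begin
  𝟙 _ ∘ app ◇ (edge e3)                                    ≈⟨ ∘-resp-≈ˡ (mon-idʳ _) ⟨
  (δ◇◇ (rep s□◇) ∘ app ◇ (ε◇ (rep s□◇))) ∘ app ◇ (edge e3) ≈⟨ by-functoriality refl ⟩
  δ◇◇ (rep s□◇) ∘ app ◇ (edge e5 ∘ edge e3)                ≈⟨ ∘-resp-≈ʳ (app-cong ◇ e4∘e2≈e5∘e3) ⟨
  δ◇◇ (rep s□◇) ∘ app ◇ (edge e4 ∘ edge e2)                ≈⟨ by-functoriality refl ⟩
  (δ◇◇ (rep s□◇) ∘ app ◇ (edge e4)) ∘ app ◇ (edge e2)      ≈⟨ ∘-resp-≈ˡ (nat-δ◇◇ (app □ (ε◇ []))) ⟩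
  (edge e4 ∘ δ◇◇ (rep s□)) ∘ app ◇ (edge e2)               ≈⟨ by-functoriality refl ⟩
  ⟦ e4 ◅ ε ⟧ ∘ δ◇◇ (rep s□) ∘ app ◇ (edge e2)              ∎)
collapse-edge ◇ e4 = e4 ◅ ε , ≈-trans (nat-δ◇◇ (app □ (ε◇ []))) (by-functoriality refl)
collapse-edge ◇ e5 = ε , ≈-trans (mon-idʳ _) (by-functoriality refl)
collapse-edge ◇ e6 = e6 ◅ ε , (begin
  δ◇◇ [] ∘ app ◇ (edge e6)                                ≈⟨ by-functoriality refl ⟩
  (δ◇◇ [] ∘ app ◇ (δ◇◇ [])) ∘ app ◇ (app ◇ (ε□ (rep s◇))) ≈⟨ ∘-resp-≈ˡ (mon-assoc []) ⟩
  (δ◇◇ [] ∘ δ◇◇ (rep s◇)) ∘ app ◇ (app ◇ (ε□ (rep s◇)))   ≈⟨ by-functoriality refl ⟩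
  δ◇◇ [] ∘ δ◇◇ (rep s◇) ∘ app ◇ (app ◇ (ε□ (rep s◇)))     ≈⟨ ∘-resp-≈ʳ (nat-δ◇◇ (ε□ (rep s◇))) ⟩
  δ◇◇ [] ∘ app ◇ (ε□ (rep s◇)) ∘ δ◇◇ (rep s□◇)            ≈⟨ by-functoriality refl ⟩
  ⟦ e6 ◅ ε ⟧ ∘ δ◇◇ (rep s□◇)                              ∎)
collapse-edge ◇ e7 = e4 ◅ e6 ◅ ε , ≈-up-to-functoriality refl (≈-sym e6∘e4≈◇ε□) refl
collapse-edge ◇ e8 = ε , ≈-trans (mon-idʳ _) (by-functoriality refl)

collapse-path : (M : Op) (p : Reachable X Y) → PathSquare (collapse M X) (collapse M Y) (app M ⟦ p ⟧)
collapse-path M ε       = ε , by-functoriality refl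
collapse-path M (e ◅ p) =
  PathSquare-resp-≈ (app-∘ M _ _) (PathSquare-paste (collapse-edge M e) (collapse-path M p))

ε□∘□f∘δ□□≈f : (f : Term (□ ∷ A) (□ ∷ B)) → ε□ (□ ∷ B) ∘ app □ f ∘ δ□□ A ≈ f
ε□∘□f∘δ□□≈f {A} {B} f = begin
  ε□ (□ ∷ B) ∘ app □ f ∘ δ□□ A   ≈⟨ by-functoriality refl ⟩
  (ε□ (□ ∷ B) ∘ app □ f) ∘ δ□□ A ≈⟨ ∘-resp-≈ˡ (nat-ε□ f) ⟩
  (f ∘ ε□ (□ ∷ A)) ∘ δ□□ A       ≈⟨ by-functoriality refl ⟩
  f ∘ ε□ (□ ∷ A) ∘ δ□□ A         ≈⟨ ∘-resp-≈ʳ (com-idˡ A) ⟩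
  f ∘ 𝟙 _                        ≈⟨ idʳ f ⟩
  f                              ∎

◇-extension∘δ◇◇ : (g : Term A (◇ ∷ B)) → (δ◇◇ B ∘ app ◇ g) ∘ δ◇◇ A ≈ δ◇◇ B ∘ app ◇ (δ◇◇ B ∘ app ◇ g)
◇-extension∘δ◇◇ {A} {B} g = begin
  (δ◇◇ B ∘ app ◇ g) ∘ δ◇◇ A                 ≈⟨ by-functoriality refl ⟩
  δ◇◇ B ∘ app ◇ g ∘ δ◇◇ A                   ≈⟨ ∘-resp-≈ʳ (nat-δ◇◇ g) ⟨
  δ◇◇ B ∘ δ◇◇ (◇ ∷ B) ∘ app ◇ (app ◇ g)     ≈⟨ by-functoriality refl ⟩
  (δ◇◇ B ∘ δ◇◇ (◇ ∷ B)) ∘ app ◇ (app ◇ g)   ≈⟨ ∘-resp-≈ˡ (mon-assoc B) ⟨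
  (δ◇◇ B ∘ app ◇ (δ◇◇ B)) ∘ app ◇ (app ◇ g) ≈⟨ by-functoriality refl ⟩
  δ◇◇ B ∘ app ◇ (δ◇◇ B ∘ app ◇ g)           ∎

ε□-square : (X : Seven) → PathSquare (collapse □ X) (𝟙 (rep X)) (ε□ (rep X))
ε□-square s□   = ε , by-functoriality refl
ε□-square s□◇□ = ε , by-functoriality refl
ε□-square s◇□  = e2 ◅ ε , by-functoriality refl
ε□-square s□◇  = ε , by-functoriality refl
ε□-square s◇□◇ = e5 ◅ ε , ≈-up-to-functoriality refl ε□≈e5∘□e6 refl
ε□-square s◇   = e5 ◅ e6 ◅ ε , ≈-up-to-functoriality refl (≈-sym e6∘e5≈ε□) refl
ε□-square s∅   = e7 ◅ ε , by-functoriality refl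

ε◇-square : (X : Seven) → PathSquare (𝟙 (rep X)) (collapse ◇ X) (ε◇ (rep X))
ε◇-square s□   = e1 ◅ e2 ◅ ε , ≈-up-to-functoriality refl (≈-sym e2∘e1≈ε◇) refl
ε◇-square s□◇□ = e2 ◅ ε , (begin
  (δ◇◇ (rep s□) ∘ app ◇ (edge e2)) ∘ ε◇ (rep s□◇□) ≈⟨ by-functoriality refl ⟩
  δ◇◇ (rep s□) ∘ app ◇ (edge e2) ∘ ε◇ (rep s□◇□)   ≈⟨ ∘-resp-≈ʳ (nat-ε◇ (edge e2)) ⟩
  δ◇◇ (rep s□) ∘ ε◇ (rep s◇□) ∘ edge e2            ≈⟨ by-functoriality refl ⟩
  (δ◇◇ (rep s□) ∘ ε◇ (rep s◇□)) ∘ edge e2          ≈⟨ ∘-resp-≈ˡ (mon-idˡ _) ⟩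
  𝟙 _ ∘ edge e2                                    ≈⟨ by-functoriality refl ⟩
  ⟦ e2 ◅ ε ⟧ ∘ 𝟙 _                                 ∎)
ε◇-square s◇□  = ε , ≈-up-to-functoriality refl (mon-idˡ _) refl
ε◇-square s□◇  = e5 ◅ ε , by-functoriality refl
ε◇-square s◇□◇ = ε , ≈-up-to-functoriality refl (mon-idˡ _) refl
ε◇-square s◇   = ε , ≈-up-to-functoriality refl (mon-idˡ _) refl
ε◇-square s∅   = e8 ◅ ε , by-functoriality refl

δ□□-square : (X : Seven) →
             PathSquare (collapse □ X) (collapse □ (prefix □ X) ∘ app □ (collapse □ X)) (δ□□ (rep X))
δ□□-square s□   = ε , ≈-up-to-functoriality refl (ε□∘□f∘δ□□≈f (collapse □ s□)) refl
δ□□-square s□◇□ = ε , ≈-up-to-functoriality refl (ε□∘□f∘δ□□≈f (collapse □ s□◇□)) refl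
δ□□-square s◇□  = ε , ≈-up-to-functoriality refl (ε□∘□f∘δ□□≈f (collapse □ s◇□)) refl
δ□□-square s□◇  = ε , ≈-up-to-functoriality refl (ε□∘□f∘δ□□≈f (collapse □ s□◇)) refl
δ□□-square s◇□◇ = ε , ≈-up-to-functoriality refl (ε□∘□f∘δ□□≈f (collapse □ s◇□◇)) refl
δ□□-square s◇   = ε , ≈-up-to-functoriality refl (ε□∘□f∘δ□□≈f (collapse □ s◇)) refl
δ□□-square s∅   = ε , ≈-up-to-functoriality refl (ε□∘□f∘δ□□≈f (collapse □ s∅)) refl

δ◇◇-square : (X : Seven) →
             PathSquare (collapse ◇ (prefix ◇ X) ∘ app ◇ (collapse ◇ X)) (collapse ◇ X) (δ◇◇ (rep X))
δ◇◇-square s□   = ε , by-functoriality refl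
δ◇◇-square s□◇□ = ε , ≈-up-to-functoriality refl (◇-extension∘δ◇◇ (edge e2)) refl
δ◇◇-square s◇□  = ε , ≈-up-to-functoriality refl (◇-extension∘δ◇◇ (𝟙 _)) refl
δ◇◇-square s□◇  = ε , by-functoriality refl
δ◇◇-square s◇□◇ = ε , ≈-up-to-functoriality refl (◇-extension∘δ◇◇ (𝟙 _)) refl
δ◇◇-square s◇   = ε , ≈-up-to-functoriality refl (◇-extension∘δ◇◇ (𝟙 _)) refl
δ◇◇-square s∅   = ε , by-functoriality refl

simulate : (f : Term A B) → PathSquare (toRep A) (toRep B) f
simulate (𝟙 A) = ε , by-functoriality refl
simulate (ε□ A) with ε□-square (classify A)
... | q , sq = q , (begin
  toRep A ∘ ε□ A                                      ≈⟨ nat-ε□ (toRep A) ⟨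
  ε□ _ ∘ app □ (toRep A)                              ≈⟨ by-functoriality refl ⟩
  (𝟙 _ ∘ ε□ _) ∘ app □ (toRep A)                      ≈⟨ ∘-resp-≈ˡ sq ⟩
  (⟦ q ⟧ ∘ collapse □ (classify A)) ∘ app □ (toRep A) ≈⟨ by-functoriality refl ⟩
  ⟦ q ⟧ ∘ toRep (□ ∷ A)                               ∎)
simulate (ε◇ A) with ε◇-square (classify A)
... | q , sq = q , (begin
  toRep (◇ ∷ A) ∘ ε◇ A                             ≈⟨ by-functoriality refl ⟩
  collapse ◇ (classify A) ∘ app ◇ (toRep A) ∘ ε◇ A ≈⟨ ∘-resp-≈ʳ (nat-ε◇ (toRep A)) ⟩
  collapse ◇ (classify A) ∘ ε◇ _ ∘ toRep A         ≈⟨ by-functoriality refl ⟩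
  (collapse ◇ (classify A) ∘ ε◇ _) ∘ toRep A       ≈⟨ ∘-resp-≈ˡ sq ⟩
  (⟦ q ⟧ ∘ 𝟙 _) ∘ toRep A                          ≈⟨ by-functoriality refl ⟩
  ⟦ q ⟧ ∘ toRep A                                  ∎)
simulate (δ□□ A) with δ□□-square (classify A)
... | q , sq = q , (begin
  toRep (□ ∷ □ ∷ A) ∘ δ□□ A                           ≈⟨ by-functoriality refl ⟩
  u ∘ app □ (app □ (toRep A)) ∘ δ□□ A                 ≈⟨ ∘-resp-≈ʳ (nat-δ□□ (toRep A)) ⟩
  u ∘ δ□□ _ ∘ app □ (toRep A)                         ≈⟨ by-functoriality refl ⟩
  (u ∘ δ□□ _) ∘ app □ (toRep A)                       ≈⟨ ∘-resp-≈ˡ sq ⟩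
  (⟦ q ⟧ ∘ collapse □ (classify A)) ∘ app □ (toRep A) ≈⟨ by-functoriality refl ⟩
  ⟦ q ⟧ ∘ toRep (□ ∷ A)                               ∎)
  where u = collapse □ (prefix □ (classify A)) ∘ app □ (collapse □ (classify A))
simulate (δ◇◇ A) with δ◇◇-square (classify A)
... | q , sq = q , (begin
  toRep (◇ ∷ A) ∘ δ◇◇ A                                       ≈⟨ by-functoriality refl ⟩
  collapse ◇ (classify A) ∘ app ◇ (toRep A) ∘ δ◇◇ A           ≈⟨ ∘-resp-≈ʳ (nat-δ◇◇ (toRep A)) ⟨
  collapse ◇ (classify A) ∘ δ◇◇ _ ∘ app ◇ (app ◇ (toRep A))   ≈⟨ by-functoriality refl ⟩
  (collapse ◇ (classify A) ∘ δ◇◇ _) ∘ app ◇ (app ◇ (toRep A)) ≈⟨ ∘-resp-≈ˡ sq ⟩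
  (⟦ q ⟧ ∘ collapse ◇ (prefix ◇ (classify A)) ∘ app ◇ (collapse ◇ (classify A))) ∘ app ◇ (app ◇ (toRep A))
    ≈⟨ by-functoriality refl ⟩
  ⟦ q ⟧ ∘ toRep (◇ ∷ ◇ ∷ A)                                   ∎)
simulate (g ∘ f) = PathSquare-paste (simulate f) (simulate g)
simulate (app {A} {B} M f) with simulate f
... | p , sq with collapse-path M p
... | q , sq′ = q , (begin
  toRep (M ∷ B) ∘ app M f                                   ≈⟨ by-functoriality refl ⟩
  collapse M (classify B) ∘ app M (toRep B ∘ f)             ≈⟨ ∘-resp-≈ʳ (app-cong M sq) ⟩
  collapse M (classify B) ∘ app M (⟦ p ⟧ ∘ toRep A)         ≈⟨ by-functoriality refl ⟩
  (collapse M (classify B) ∘ app M ⟦ p ⟧) ∘ app M (toRep A) ≈⟨ ∘-resp-≈ˡ sq′ ⟩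
  (⟦ q ⟧ ∘ collapse M (classify A)) ∘ app M (toRep A)       ≈⟨ by-functoriality refl ⟩
  ⟦ q ⟧ ∘ toRep (M ∷ A)                                     ∎)

toRep-monic : {f g : Term A B} → toRep B ∘ f ≈ toRep B ∘ g → f ≈ g
toRep-monic {B = B} {f} {g} eq = begin
  f                         ≈⟨ idˡ f ⟨
  𝟙 B ∘ f                   ≈⟨ ∘-resp-≈ˡ (fromRep∘toRep≈id B) ⟨
  (fromRep B ∘ toRep B) ∘ f ≈⟨ assoc _ _ _ ⟨
  fromRep B ∘ toRep B ∘ f   ≈⟨ ∘-resp-≈ʳ eq ⟩
  fromRep B ∘ toRep B ∘ g   ≈⟨ assoc _ _ _ ⟩
  (fromRep B ∘ toRep B) ∘ g ≈⟨ ∘-resp-≈ˡ (fromRep∘toRep≈id B) ⟩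
  𝟙 B ∘ g                   ≈⟨ idˡ g ⟩
  g                         ∎

arrows-unique : (f g : Term A B) → f ≈ g
arrows-unique f g with simulate f | simulate g
... | p , sqf | q , sqg = toRep-monic (≈-trans sqf (≈-trans (∘-resp-≈ˡ (⟦⟧-unique p q)) (≈-sym sqg)))

arrow→reachable : Term (rep X) (rep Y) → Reachable X Y
arrow→reachable {X} {Y} f = subst₂ Reachable (classify-rep X) (classify-rep Y) (proj₁ (simulate f))

classify-unique : Iso A (rep Y) → Y ≡ classify A
classify-unique {A} {Y} (f , g , _) = reachable-antisym
  (subst (λ W → Reachable W (classify A)) (classify-rep Y) (proj₁ (simulate g)))
  (subst (Reachable (classify A)) (classify-rep Y) (proj₁ (simulate f)))

mainTheorem7 :
    ((A B : Modality) (f g : Term A B) → f ≈ g)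
    × ((A : Modality) → Σ Seven λ X → Iso A (rep X) × ((Y : Seven) → Iso A (rep Y) → Y ≡ X))
    × ((X Y : Seven) → (Term (rep X) (rep Y) → Reachable X Y) × (Reachable X Y → Term (rep X) (rep Y)))
mainTheorem7 =
    (λ _ _ → arrows-unique)
  , (λ A → classify A , classify-iso A , λ _ → classify-unique)
  , (λ _ _ → arrow→reachable , ⟦_⟧)
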